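{- Let $\Sigma=\{0,\dots,\sigma-1\}$ with $\sigma\ge 2$, let $m\ge 1$, and let $P$ be a random pattern of length $m$ whose characters are chosen uniformly and independently from $\Sigma$. Let $P^*=P[\tau(1)]P[\tau(2)]\cdots P[\tau(m)]$ where $\tau$ is a fixed permutation of $\{1,\dots,m\}$ (not depending on $P$), and let $\ell_1\le u_1,\dots,\ell_m\le u_m$ be fixed nonnegative integers. For $1\le l\le m$, let $D_l$ be the set of vectors $\delta\in\{0,\dots,\sigma-1\}^l$ such that for every $j\le l$ the number of nonzero entries among $\delta[1],\dots,\delta[j]$ lies between $\ell_j$ and $u_j$, and let $\mathcal A_l=\{A_\delta:\delta\in D_l\}$ where $A_\delta[j]=(P^*[j]+\delta[j])\bmod\sigma$ for $j=1,\dots,l$; order $\mathcal A_l$ as $A_{l,1},A_{l,2},\dots$ according to the lexicographic order of the vectors $\delta$. Then for every $l$ and every $i$, the random string $A_{l,i}$ is uniformly distributed over $\Sigma^l$.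
   Context: This formalizes the following setting: a search with a given pattern partition reads the pattern characters in a fixed order, giving the string $P^*$; the strings enumerated at depth $l$ of the search trie (when the text contains all strings) are exactly those of length $l$ whose number of mismatches with the length-$j$ prefix of $P^*$ lies in $[\ell_j,u_j]$ for every $j\le l$, and children in the trie are ordered so that the edge labelled $P^*[l]$ comes first, followed by $(P^*[l]+1)\bmod\sigma,\dots,(P^*[l]+\sigma-1)\bmod\sigma$; $A_{l,i}$ is the string of the $i$-th node (from left to right) at depth $l$. -}

module Defs where

open import Data.Nat using (ℕ; zero; suc; _+_; _≤_; _≤?_)
open import Data.Nat.DivMod using (_mod_)
open import Data.Fin using (Fin; zero; suc; toℕ; inject≤)
open import Data.Fin.Permutation using (Permutation; _⟨$⟩ʳ_)
import Data.Fin.Properties as FinP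
open import Data.List using (List; []; _∷_; map; concatMap; filter; length; take)
open import Data.Vec using (Vec; []; _∷_; lookup; tabulate; toList)
import Data.Vec.Properties as VecP
open import Data.Product using (_×_)
open import Relation.Nullary.Decidable using (Dec; _×-dec_)
open import Relation.Binary.PropositionalEquality using (_≡_)

-- All vectors of length n over Fin σ, listed in lexicographic order
-- (first coordinate most significant, 0 < 1 < ... < σ-1).
allVecs : (σ n : ℕ) → List (Vec (Fin σ) n)
allVecs σ zero    = [] ∷ []
allVecs σ (suc n) = concatMap (λ d → map (d ∷_) (allVecs σ n)) (allFinL σ)
  where open import Data.List using () renaming (allFin to allFinL)

nnz : {σ : ℕ} → List (Fin σ) → ℕ
nnz []            = 0
nnz (zero  ∷ xs)  = nnz xs
nnz (suc _ ∷ xs)  = suc (nnz xs)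

-- δ ∈ D_l : for every j = 1..l (here 0-indexed k = j-1), the number of
-- nonzero entries among δ[1..j] lies in [ℓ_j , u_j].
InD : (σ m : ℕ) (ℓ u : Fin m → ℕ) (l : ℕ) → .(l ≤ m) → Vec (Fin σ) l → Set
InD σ m ℓ u l l≤m δ =
  (k : Fin l) → (ℓ (inject≤ k l≤m) ≤ nnz (take (suc (toℕ k)) (toList δ)))
              × (nnz (take (suc (toℕ k)) (toList δ)) ≤ u (inject≤ k l≤m))

InD? : (σ m : ℕ) (ℓ u : Fin m → ℕ) (l : ℕ) .(l≤m : l ≤ m) (δ : Vec (Fin σ) l) →
       Dec (InD σ m ℓ u l l≤m δ)
InD? σ m ℓ u l l≤m δ = FinP.all? λ k →
  (ℓ (inject≤ k l≤m) ≤? nnz (take (suc (toℕ k)) (toList δ)))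
  ×-dec (nnz (take (suc (toℕ k)) (toList δ)) ≤? u (inject≤ k l≤m))

D : (σ m : ℕ) (ℓ u : Fin m → ℕ) (l : ℕ) .(l≤m : l ≤ m) → List (Vec (Fin σ) l)
D σ m ℓ u l l≤m = filter (InD? σ m ℓ u l l≤m) (allVecs σ l)

addMod : {σ : ℕ} → Fin σ → Fin σ → Fin σ
addMod {suc s} a b = (toℕ a + toℕ b) mod (suc s)

Pstar : {σ m : ℕ} → Permutation m m → Vec (Fin σ) m → Fin m → Fin σ
Pstar τ P j = lookup P (τ ⟨$⟩ʳ j)

Aδ : {σ m l : ℕ} → .(l ≤ m) → Permutation m m → Vec (Fin σ) m → Vec (Fin σ) l → Vec (Fin σ) l
Aδ l≤m τ P δ = tabulate λ j → addMod (Pstar τ P (inject≤ j l≤m)) (lookup δ j)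

-- A_{l,i}: the string obtained from the i-th δ of D_l (0-indexed i)
Ali : (σ m : ℕ) (τ : Permutation m m) (ℓ u : Fin m → ℕ) (l : ℕ) .(l≤m : l ≤ m) →
      Fin (length (D σ m ℓ u l l≤m)) → Vec (Fin σ) m → Vec (Fin σ) l
Ali σ m τ ℓ u l l≤m i P = Aδ l≤m τ P (lookupL (D σ m ℓ u l l≤m) i)
  where open import Data.List using () renaming (lookup to lookupL)

countPatterns : (σ m : ℕ) (τ : Permutation m m) (ℓ u : Fin m → ℕ) (l : ℕ) .(l≤m : l ≤ m) →
                Fin (length (D σ m ℓ u l l≤m)) → Vec (Fin σ) l → ℕ
countPatterns σ m τ ℓ u l l≤m i x =
  length (filter (λ P → VecP.≡-dec FinP._≟_ (Ali σ m τ ℓ u l l≤m i P) x) (allVecs σ m))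

-- The string A_δ is the length-l prefix of the vector obtained from P by first
-- permuting its positions by τ and then adding δ (padded with zeros) coordinatewise
-- modulo σ. Both operations are bijections of Σ^m, so they carry the uniform
-- distribution on patterns to itself, and the prefix of a uniform vector is uniform:
-- each x ∈ Σ^l is the prefix of exactly σ^(m-l) vectors. This holds for every single
-- δ, so neither the order of D_l nor the bounds ℓ, u play any role.
module Submission where

open import Defs
open import Data.Nat using (ℕ; _≤_; _^_; _∸_)
open import Data.Fin using (Fin)
open import Data.Fin.Permutation using (Permutation)
open import Data.List using (length)
open import Data.Vec using (Vec)
open import Relation.Binary.PropositionalEquality using (_≡_)

open import Data.Nat using (zero; suc; _+_; _*_; _<_; z≤n; s≤s; NonZero)
open import Data.Nat.Properties using (+-assoc; +-identityʳ; *-zeroʳ; m∸n+n≡m; m+[n∸m]≡n; <⇒≤)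
open import Data.Nat.DivMod using (_%_; _mod_; %-distribˡ-+; m%n%n≡m%n; [m+n]%n≡m%n; m<n⇒m%n≡m)
open import Data.Nat.ListAction using (sum)
open import Data.Fin using (toℕ; inject≤) renaming (zero to fzero; suc to fsuc)
open import Data.Fin.Properties using (toℕ-fromℕ<; toℕ-injective; toℕ<n; suc-injective; _≟_)
open import Data.Fin.Permutation using (_⟨$⟩ʳ_; flip; inverseʳ)
open import Data.List using (List; []; _∷_; _++_; map; concatMap; filter; tabulate; allFin; cartesianProductWith)
open import Data.List.Properties using (filter-++; length-++; filter-≐; filter-none; map-tabulate; tabulate-cong)
open import Data.List.Relation.Unary.All using ([]; universal)
open import Data.List.Relation.Unary.AllPairs using ([]; _∷_)
open import Data.List.Relation.Unary.Any using (here)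
open import Data.List.Membership.Propositional using (_∈_)
open import Data.List.Membership.Propositional.Properties using (∈-map⁺; ∈-allFin; ∈-cartesianProductWith⁺)
open import Data.List.Membership.Propositional.Properties.WithK using (unique∧set⇒bag)
open import Data.List.Relation.Unary.Unique.Propositional using (Unique)
open import Data.List.Relation.Unary.Unique.Propositional.Properties using (map⁺; allFin⁺; cartesianProductWith⁺)
open import Data.List.Relation.Binary.BagAndSetEquality using (∼bag⇒↭)
open import Data.List.Relation.Binary.Permutation.Propositional using (_↭_)
open import Data.List.Relation.Binary.Permutation.Propositional.Properties using (filter-↭; ↭-length)
open import Data.Vec using ([]; _∷_; lookup; zipWith; truncate; padRight)
open import Data.Vec.Properties using (≡-dec; ∷-injective; ∷-injectiveˡ; ∷-injectiveʳ; tabulate∘lookup; lookup∘tabulate; lookup-truncate; lookup-zipWith)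
import Data.Vec.Properties as Vecₚ
open import Data.Product using (_,_)
open import Function using (_∘_; const; id)
open import Function.Bundles using (mk⇔)
open import Relation.Nullary using (yes; no)
open import Relation.Unary using (Pred; Decidable)
open import Relation.Binary.PropositionalEquality using (_≢_; _≗_; refl; sym; trans; cong; cong₂; subst; module ≡-Reasoning)

open ≡-Reasoning

module _ {a b p} {A : Set a} {B : Set b} {P : Pred B p} (P? : Decidable P) where

  length-filter-map : (f : A → B) (xs : List A) →
                      length (filter P? (map f xs)) ≡ length (filter (P? ∘ f) xs)
  length-filter-map f []       = refl
  length-filter-map f (x ∷ xs) with P? (f x)
  ... | yes _ = cong suc (length-filter-map f xs)
  ... | no _  = length-filter-map f xs

  length-filter-concatMap : (f : A → List B) (xs : List A) →
                            length (filter P? (concatMap f xs)) ≡ sum (map (length ∘ filter P? ∘ f) xs)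
  length-filter-concatMap f []       = refl
  length-filter-concatMap f (x ∷ xs) = begin
    length (filter P? (f x ++ concatMap f xs))
      ≡⟨ cong length (filter-++ P? (f x) (concatMap f xs)) ⟩
    length (filter P? (f x) ++ filter P? (concatMap f xs))
      ≡⟨ length-++ (filter P? (f x)) ⟩
    length (filter P? (f x)) + length (filter P? (concatMap f xs))
      ≡⟨ cong (length (filter P? (f x)) +_) (length-filter-concatMap f xs) ⟩
    length (filter P? (f x)) + sum (map (length ∘ filter P? ∘ f) xs) ∎

module _ {a} {A : Set a} {f g : A → A} (inverseˡ : f ∘ g ≗ id) (inverseʳ : g ∘ f ≗ id) where

  map-inverse-↭ : {xs : List A} → Unique xs → (∀ x → x ∈ xs) → map f xs ↭ xs
  map-inverse-↭ {xs} unique complete = ∼bag⇒↭ (unique∧set⇒bag (map⁺ f-injective unique) unique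
    (λ {y} → mk⇔ (λ _ → complete y) (λ _ → subst (_∈ map f xs) (inverseˡ y) (∈-map⁺ f (complete (g y))))))
    where
    f-injective : ∀ {x y} → f x ≡ f y → x ≡ y
    f-injective {x} {y} fx≡fy = trans (sym (inverseʳ x)) (trans (cong g fx≡fy) (inverseʳ y))

sum-tabulate-const : ∀ n c → sum (tabulate {n = n} (const c)) ≡ n * c
sum-tabulate-const zero    c = refl
sum-tabulate-const (suc n) c = cong (c +_) (sum-tabulate-const n c)

sum-tabulate-single : ∀ {n} (f : Fin n → ℕ) (i : Fin n) → (∀ j → j ≢ i → f j ≡ 0) → sum (tabulate f) ≡ f i
sum-tabulate-single {suc n} f fzero vanish = begin
  f fzero + sum (tabulate (f ∘ fsuc))
    ≡⟨ cong (λ xs → f fzero + sum xs) (tabulate-cong (λ j → vanish (fsuc j) λ ())) ⟩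
  f fzero + sum (tabulate {n = n} (const 0))
    ≡⟨ cong (f fzero +_) (trans (sum-tabulate-const n 0) (*-zeroʳ n)) ⟩
  f fzero + 0
    ≡⟨ +-identityʳ (f fzero) ⟩
  f fzero ∎
sum-tabulate-single {suc n} f (fsuc i) vanish =
  cong₂ _+_ (vanish fzero λ ())
            (sum-tabulate-single (f ∘ fsuc) i λ j j≢i → vanish (fsuc j) (j≢i ∘ suc-injective))

module _ (σ : ℕ) where

  allVecs-suc : ∀ n → allVecs σ (suc n) ≡ cartesianProductWith _∷_ (allFin σ) (allVecs σ n)
  allVecs-suc n = go (allFin σ)
    where
    go : (ds : List (Fin σ)) →
         concatMap (λ d → map (d ∷_) (allVecs σ n)) ds ≡ cartesianProductWith _∷_ ds (allVecs σ n)
    go []       = refl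
    go (d ∷ ds) = cong (map (d ∷_) (allVecs σ n) ++_) (go ds)

  ∈-allVecs : ∀ {n} (v : Vec (Fin σ) n) → v ∈ allVecs σ n
  ∈-allVecs []      = here refl
  ∈-allVecs (d ∷ v) =
    subst ((d ∷ v) ∈_) (sym (allVecs-suc _)) (∈-cartesianProductWith⁺ _∷_ (∈-allFin d) (∈-allVecs v))

  allVecs-unique : ∀ n → Unique (allVecs σ n)
  allVecs-unique zero    = [] ∷ []
  allVecs-unique (suc n) =
    subst Unique (sym (allVecs-suc n)) (cartesianProductWith⁺ _∷_ ∷-injective (allFin⁺ σ) (allVecs-unique n))

  module _ {n p} {P : Pred (Vec (Fin σ) n) p} (P? : Decidable P) where

    length-filter-allVecs-∘-inverse : {f g : Vec (Fin σ) n → Vec (Fin σ) n} → f ∘ g ≗ id → g ∘ f ≗ id →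
                                      length (filter (P? ∘ f) (allVecs σ n)) ≡ length (filter P? (allVecs σ n))
    length-filter-allVecs-∘-inverse {f} f∘g g∘f = begin
      length (filter (P? ∘ f) (allVecs σ n))
        ≡⟨ sym (length-filter-map P? f (allVecs σ n)) ⟩
      length (filter P? (map f (allVecs σ n)))
        ≡⟨ ↭-length (filter-↭ P? (map-inverse-↭ f∘g g∘f (allVecs-unique n) ∈-allVecs)) ⟩
      length (filter P? (allVecs σ n)) ∎

  module _ {n p} {P : Pred (Vec (Fin σ) (suc n)) p} (P? : Decidable P) where

    length-filter-allVecs-suc : length (filter P? (allVecs σ (suc n))) ≡
                                sum (tabulate λ d → length (filter (P? ∘ (d ∷_)) (allVecs σ n)))
    length-filter-allVecs-suc = begin
      length (filter P? (allVecs σ (suc n)))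
        ≡⟨ length-filter-concatMap P? (λ d → map (d ∷_) (allVecs σ n)) (allFin σ) ⟩
      sum (map (λ d → length (filter P? (map (d ∷_) (allVecs σ n)))) (allFin σ))
        ≡⟨ cong sum (map-tabulate id λ d → length (filter P? (map (d ∷_) (allVecs σ n)))) ⟩
      sum (tabulate λ d → length (filter P? (map (d ∷_) (allVecs σ n))))
        ≡⟨ cong sum (tabulate-cong λ d → length-filter-map P? (d ∷_) (allVecs σ n)) ⟩
      sum (tabulate λ d → length (filter (P? ∘ (d ∷_)) (allVecs σ n))) ∎

  length-filter-truncate-allVecs : ∀ {l m} (l≤m : l ≤ m) (x : Vec (Fin σ) l) →
    length (filter (λ v → ≡-dec _≟_ (truncate l≤m v) x) (allVecs σ m)) ≡ σ ^ (m ∸ l)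
  length-filter-truncate-allVecs {m = zero}  z≤n [] = refl
  length-filter-truncate-allVecs {m = suc m} z≤n [] = begin
    length (filter (λ v → ≡-dec _≟_ [] []) (allVecs σ (suc m)))
      ≡⟨ length-filter-allVecs-suc (λ v → ≡-dec _≟_ [] []) ⟩
    sum (tabulate {n = σ} (const (length (filter (λ v → ≡-dec _≟_ [] []) (allVecs σ m)))))
      ≡⟨ sum-tabulate-const σ _ ⟩
    σ * length (filter (λ v → ≡-dec _≟_ [] []) (allVecs σ m))
      ≡⟨ cong (σ *_) (length-filter-truncate-allVecs {m = m} z≤n []) ⟩
    σ * σ ^ m ∎
  length-filter-truncate-allVecs {suc l} {suc m} (s≤s l≤m) (c ∷ x) = begin
    length (filter matches (allVecs σ (suc m)))
      ≡⟨ length-filter-allVecs-suc matches ⟩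
    sum (tabulate count-after)
      ≡⟨ sum-tabulate-single count-after c count-after-≢ ⟩
    count-after c
      ≡⟨ cong length (filter-≐ _ _ (∷-injectiveʳ , cong (c ∷_)) (allVecs σ m)) ⟩
    length (filter (λ v → ≡-dec _≟_ (truncate l≤m v) x) (allVecs σ m))
      ≡⟨ length-filter-truncate-allVecs l≤m x ⟩
    σ ^ (m ∸ l) ∎
    where
    matches : Decidable (λ v → truncate (s≤s l≤m) v ≡ c ∷ x)
    matches v = ≡-dec _≟_ (truncate (s≤s l≤m) v) (c ∷ x)
    count-after : Fin σ → ℕ
    count-after d = length (filter (matches ∘ (d ∷_)) (allVecs σ m))
    count-after-≢ : ∀ d → d ≢ c → count-after d ≡ 0
    count-after-≢ d d≢c =
      cong length (filter-none (matches ∘ (d ∷_)) (universal (λ v → d≢c ∘ ∷-injectiveˡ) (allVecs σ m)))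

[[a+b]%n+c]%n≡a : ∀ {a} b c n .{{_ : NonZero n}} → a < n → b + c ≡ n → ((a + b) % n + c) % n ≡ a
[[a+b]%n+c]%n≡a {a} b c n a<n b+c≡n = begin
  ((a + b) % n + c) % n             ≡⟨ %-distribˡ-+ ((a + b) % n) c n ⟩
  ((a + b) % n % n + c % n) % n     ≡⟨ cong (λ k → (k + c % n) % n) (m%n%n≡m%n (a + b) n) ⟩
  ((a + b) % n + c % n) % n         ≡⟨ sym (%-distribˡ-+ (a + b) c n) ⟩
  (a + b + c) % n                   ≡⟨ cong (_% n) (trans (+-assoc a b c) (cong (a +_) b+c≡n)) ⟩
  (a + n) % n                       ≡⟨ [m+n]%n≡m%n a n ⟩
  a % n                             ≡⟨ m<n⇒m%n≡m a<n ⟩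
  a ∎

module Modular (s : ℕ) where

  subMod : Fin (suc s) → Fin (suc s) → Fin (suc s)
  subMod a b = (toℕ a + (suc s ∸ toℕ b)) mod suc s

  toℕ-mod : ∀ k → toℕ (k mod suc s) ≡ k % suc s
  toℕ-mod k = toℕ-fromℕ< _

  addMod-subMod : ∀ a b → addMod (subMod a b) b ≡ a
  addMod-subMod a b = toℕ-injective (begin
    toℕ (addMod (subMod a b) b)
      ≡⟨ toℕ-mod (toℕ (subMod a b) + toℕ b) ⟩
    (toℕ (subMod a b) + toℕ b) % suc s
      ≡⟨ cong (λ k → (k + toℕ b) % suc s) (toℕ-mod (toℕ a + (suc s ∸ toℕ b))) ⟩
    ((toℕ a + (suc s ∸ toℕ b)) % suc s + toℕ b) % suc s
      ≡⟨ [[a+b]%n+c]%n≡a (suc s ∸ toℕ b) (toℕ b) (suc s) (toℕ<n a) (m∸n+n≡m (<⇒≤ (toℕ<n b))) ⟩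
    toℕ a ∎)

  subMod-addMod : ∀ a b → subMod (addMod a b) b ≡ a
  subMod-addMod a b = toℕ-injective (begin
    toℕ (subMod (addMod a b) b)
      ≡⟨ toℕ-mod (toℕ (addMod a b) + (suc s ∸ toℕ b)) ⟩
    (toℕ (addMod a b) + (suc s ∸ toℕ b)) % suc s
      ≡⟨ cong (λ k → (k + (suc s ∸ toℕ b)) % suc s) (toℕ-mod (toℕ a + toℕ b)) ⟩
    ((toℕ a + toℕ b) % suc s + (suc s ∸ toℕ b)) % suc s
      ≡⟨ [[a+b]%n+c]%n≡a (toℕ b) (suc s ∸ toℕ b) (suc s) (toℕ<n a) (m+[n∸m]≡n (<⇒≤ (toℕ<n b))) ⟩
    toℕ a ∎)

module _ {a} {A : Set a} where

  permute : ∀ {m} → Permutation m m → Vec A m → Vec A m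
  permute τ v = Data.Vec.tabulate (lookup v ∘ (τ ⟨$⟩ʳ_))

  permute-flip : ∀ {m} (τ : Permutation m m) → permute (flip τ) ∘ permute τ ≗ id
  permute-flip τ v = trans (Vecₚ.tabulate-cong entry) (tabulate∘lookup v)
    where
    entry : ∀ k → lookup (permute τ v) (flip τ ⟨$⟩ʳ k) ≡ lookup v k
    entry k = trans (lookup∘tabulate (lookup v ∘ (τ ⟨$⟩ʳ_)) (flip τ ⟨$⟩ʳ k)) (cong (lookup v) (inverseʳ τ))

  lookup-padRight-inject≤ : ∀ {l m} (l≤m : l ≤ m) (c : A) (v : Vec A l) (j : Fin l) →
                            lookup (padRight l≤m c v) (inject≤ j l≤m) ≡ lookup v j
  lookup-padRight-inject≤ (s≤s l≤m) c (x ∷ v) fzero    = refl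
  lookup-padRight-inject≤ (s≤s l≤m) c (x ∷ v) (fsuc j) = lookup-padRight-inject≤ l≤m c v j

  zipWith-cancelʳ : ∀ {b} {B : Set b} {f : A → B → A} {g : A → B → A} → (∀ x y → g (f x y) y ≡ x) →
                    ∀ {n} (xs : Vec A n) (ys : Vec B n) → zipWith g (zipWith f xs ys) ys ≡ xs
  zipWith-cancelʳ cancel []       []       = refl
  zipWith-cancelʳ cancel (x ∷ xs) (y ∷ ys) = cong₂ _∷_ (cancel x y) (zipWith-cancelʳ cancel xs ys)

module Shift (s m l : ℕ) (l≤m : l ≤ m) (τ : Permutation m m) (δ : Vec (Fin (suc s)) l) where
  open Modular s

  offset : Vec (Fin (suc s)) m
  offset = padRight l≤m fzero δ

  translate untranslate : Vec (Fin (suc s)) m → Vec (Fin (suc s)) m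
  translate   v = zipWith addMod v offset
  untranslate v = zipWith subMod v offset

  Aδ≡truncate-translate-permute : ∀ P → Aδ l≤m τ P δ ≡ truncate l≤m (translate (permute τ P))
  Aδ≡truncate-translate-permute P = trans (Vecₚ.tabulate-cong entry) (tabulate∘lookup _)
    where
    entry : ∀ j → addMod (lookup P (τ ⟨$⟩ʳ inject≤ j l≤m)) (lookup δ j) ≡
                  lookup (truncate l≤m (translate (permute τ P))) j
    entry j = sym (begin
      lookup (truncate l≤m (translate (permute τ P))) j
        ≡⟨ lookup-truncate l≤m _ j ⟩
      lookup (translate (permute τ P)) (inject≤ j l≤m)
        ≡⟨ lookup-zipWith addMod (inject≤ j l≤m) (permute τ P) offset ⟩
      addMod (lookup (permute τ P) (inject≤ j l≤m)) (lookup offset (inject≤ j l≤m))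
        ≡⟨ cong₂ addMod (lookup∘tabulate _ (inject≤ j l≤m)) (lookup-padRight-inject≤ l≤m fzero δ j) ⟩
      addMod (lookup P (τ ⟨$⟩ʳ inject≤ j l≤m)) (lookup δ j) ∎)

  length-filter-Aδ : (x : Vec (Fin (suc s)) l) →
    length (filter (λ P → ≡-dec _≟_ (Aδ l≤m τ P δ) x) (allVecs (suc s) m)) ≡ suc s ^ (m ∸ l)
  length-filter-Aδ x = begin
    length (filter (λ P → ≡-dec _≟_ (Aδ l≤m τ P δ) x) (allVecs (suc s) m))
      ≡⟨ cong length (filter-≐ _ _ ((λ {P} → trans (sym (Aδ≡ P))) , (λ {P} → trans (Aδ≡ P))) (allVecs (suc s) m)) ⟩
    length (filter (prefix? ∘ translate ∘ permute τ) (allVecs (suc s) m))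
      ≡⟨ length-filter-allVecs-∘-inverse (suc s) (prefix? ∘ translate) {g = permute (flip τ)}
           (permute-flip (flip τ)) (permute-flip τ) ⟩
    length (filter (prefix? ∘ translate) (allVecs (suc s) m))
      ≡⟨ length-filter-allVecs-∘-inverse (suc s) prefix? {g = untranslate}
           (λ v → zipWith-cancelʳ addMod-subMod v offset) (λ v → zipWith-cancelʳ subMod-addMod v offset) ⟩
    length (filter prefix? (allVecs (suc s) m))
      ≡⟨ length-filter-truncate-allVecs (suc s) l≤m x ⟩
    suc s ^ (m ∸ l) ∎
    where
    prefix? : Decidable (λ v → truncate l≤m v ≡ x)
    prefix? v = ≡-dec _≟_ (truncate l≤m v) x
    Aδ≡ = Aδ≡truncate-translate-permute

lemma2 : (σ m : ℕ) → 2 ≤ σ → 1 ≤ m → (τ : Permutation m m) →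
         (ℓ u : Fin m → ℕ) → (∀ j → ℓ j ≤ u j) →
         (l : ℕ) → 1 ≤ l → (l≤m : l ≤ m) →
         (i : Fin (length (D σ m ℓ u l l≤m))) → (x : Vec (Fin σ) l) →
         countPatterns σ m τ ℓ u l l≤m i x ≡ σ ^ (m ∸ l)
lemma2 (suc s) m _ _ τ ℓ u _ l _ l≤m i x =
  Shift.length-filter-Aδ s m l l≤m τ (Data.List.lookup (D (suc s) m ℓ u l l≤m) i) x
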